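{- For every integer $k \geq 3$ there are infinitely many positive integers $n$ such that the map $pre_k$, restricted to the set of partitions of $n$ having exactly $k$ parts, is not injective. In particular, the statement "for every $k\ge 3$ and every $n$, $pre_k$ is injective on the set of partitions of $n$ with at least $k$ parts" is false.
   Context: A partition $\lambda=(\lambda_1,\dots,\lambda_\ell)$ of $n$ is a non-increasing sequence of positive integers summing to $n$; $\ell$ is its number of parts. For $k\ge 1$, $pre_k(\lambda)$ is the partition whose multiset of parts is $\{\lambda_{i_1}\lambda_{i_2}\cdots\lambda_{i_k} : 1\le i_1<i_2<\cdots<i_k\le \ell\}$ if $\ell\ge k$, and is the empty partition if $\ell<k$. (E.g. $pre_2(7,4,4)=(28,28,16)$.) -}

module Defs where

open import Data.Nat using (ℕ; zero; suc; _+_; _*_; _≤_; _≥_; _<_; _≤ᵇ_)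
open import Data.Bool using (if_then_else_)
open import Data.List using (List; []; _∷_; map; _++_; length)
open import Data.Nat.ListAction using (sum; product)
open import Data.List.Relation.Unary.All using (All)
open import Data.List.Relation.Unary.Linked using (Linked)
open import Data.Product using (_×_)
open import Relation.Binary.PropositionalEquality using (_≡_)

IsPartition : ℕ → List ℕ → Set
IsPartition n λs = Linked _≥_ λs × All (λ x → 1 ≤ x) λs × sum λs ≡ n

choose : ℕ → List ℕ → List (List ℕ)
choose zero    xs       = [] ∷ []
choose (suc k) []       = []
choose (suc k) (x ∷ xs) = map (x ∷_) (choose k xs) ++ choose (suc k) xs

insertDesc : ℕ → List ℕ → List ℕ
insertDesc x []       = x ∷ []
insertDesc x (y ∷ ys) = if y ≤ᵇ x then x ∷ y ∷ ys else y ∷ insertDesc x ys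

sortDesc : List ℕ → List ℕ
sortDesc []       = []
sortDesc (x ∷ xs) = insertDesc x (sortDesc xs)

-- pre_k(λ): the partition whose parts are the products λ_{i₁}⋯λ_{iₖ} over all
-- i₁ < … < iₖ, listed non-increasingly; empty if λ has fewer than k parts
-- (then 'choose k λ' is empty).
pre : ℕ → List ℕ → List ℕ
pre k λs = sortDesc (map product (choose k λs))

{-# OPTIONS --safe #-}
module Submission where

-- A partition with exactly k parts has a single k-fold product, so pre_k sends it to the
-- one-part partition (∏ λ); it therefore suffices to find distinct k-part partitions of n
-- with equal products. The partitions (6,6,1) and (9,2,2) of 13 both have product 36;
-- multiplying every part by t and appending k − 3 parts equal to t (the smallest part)
-- preserves equality of sums and of products and makes n = (10 + k)·t as large as needed.

open import Defs
open import Data.Nat using (ℕ; zero; suc; _+_; _*_; _^_; _≤_; _≥_; _<_; s≤s; z≤n; NonZero; >-nonZero⁻¹)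
open import Data.Nat.Properties
  using (≤-refl; ≤-trans; n≤1+n; <⇒≤; m≤m+n; m≤n*m; *-mono-≤; *-monoˡ-≤; *-cancelʳ-≡; *-distribʳ-+;
         [m*n]*[o*p]≡[m*o]*[n*p])
open import Data.Nat.ListAction using (sum; product)
open import Data.Nat.ListAction.Properties using (sum-++; product-++)
open import Data.List using (List; []; _∷_; _++_; map; replicate; length)
open import Data.List.Properties using (map-injective; ++-cancelʳ; length-++; length-map; length-replicate)
open import Data.List.Relation.Unary.All using (All; []; _∷_)
import Data.List.Relation.Unary.All as All
import Data.List.Relation.Unary.All.Properties as Allₚ
open import Data.List.Relation.Unary.Linked using (Linked; []; [-]; _∷_)
import Data.List.Relation.Unary.Linked as Linked
import Data.List.Relation.Unary.Linked.Properties as Linkedₚ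
open import Data.Product using (Σ; ∃; _×_; _,_)
open import Relation.Binary.PropositionalEquality
  using (_≡_; _≢_; refl; sym; trans; cong; cong₂; module ≡-Reasoning)

choose-length< : ∀ {k} xs → length xs < k → choose k xs ≡ []
choose-length< {suc k} []       _                = refl
choose-length< {suc k} (x ∷ xs) (s≤s |xs|<k)
  rewrite choose-length< xs |xs|<k | choose-length< {suc k} xs (s≤s (<⇒≤ |xs|<k)) = refl

choose-length : ∀ xs → choose (length xs) xs ≡ xs ∷ []
choose-length []       = refl
choose-length (x ∷ xs) rewrite choose-length xs | choose-length< xs ≤-refl = refl

pre-length : ∀ {k} xs → length xs ≡ k → pre k xs ≡ product xs ∷ []
pre-length xs refl rewrite choose-length xs = refl

sum-map-*ʳ : ∀ t xs → sum (map (_* t) xs) ≡ sum xs * t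
sum-map-*ʳ t []       = refl
sum-map-*ʳ t (x ∷ xs) = trans (cong (x * t +_) (sum-map-*ʳ t xs)) (sym (*-distribʳ-+ t x (sum xs)))

product-map-*ʳ : ∀ t xs → product (map (_* t) xs) ≡ product xs * t ^ length xs
product-map-*ʳ t []       = refl
product-map-*ʳ t (x ∷ xs) = begin
  x * t * product (map (_* t) xs)        ≡⟨ cong (x * t *_) (product-map-*ʳ t xs) ⟩
  x * t * (product xs * t ^ length xs)   ≡⟨ [m*n]*[o*p]≡[m*o]*[n*p] x t (product xs) _ ⟩
  x * product xs * t ^ suc (length xs)   ∎
  where open ≡-Reasoning

sum-replicate : ∀ j t → sum (replicate j t) ≡ j * t
sum-replicate zero    t = refl
sum-replicate (suc j) t = cong (t +_) (sum-replicate j t)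

Linked-≥-replicate : ∀ j t → Linked _≥_ (replicate j t)
Linked-≥-replicate zero          t = []
Linked-≥-replicate (suc zero)    t = [-]
Linked-≥-replicate (suc (suc j)) t = ≤-refl ∷ Linked-≥-replicate (suc j) t

Linked-≥-++-replicate : ∀ {xs} j {t} → All (t ≤_) xs → Linked _≥_ xs → Linked _≥_ (xs ++ replicate j t)
Linked-≥-++-replicate j {t} []              []          = Linked-≥-replicate j t
Linked-≥-++-replicate zero    (_   ∷ [])   [-]         = [-]
Linked-≥-++-replicate (suc j) (t≤x ∷ [])   [-]         = t≤x ∷ Linked-≥-replicate (suc j) _
Linked-≥-++-replicate j       (_   ∷ t≤xs) (x≥y ∷ xs↓) = x≥y ∷ Linked-≥-++-replicate j t≤xs xs↓

IsPartition-*ʳ : ∀ {n xs} t → 1 ≤ t → IsPartition n xs → IsPartition (n * t) (map (_* t) xs)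
IsPartition-*ʳ {xs = xs} t 1≤t (xs↓ , xs≥1 , refl) =
  Linkedₚ.map⁺ (Linked.map (*-monoˡ-≤ t) xs↓) ,
  Allₚ.map⁺ (All.map (λ 1≤x → *-mono-≤ 1≤x 1≤t) xs≥1) ,
  sum-map-*ʳ t xs

IsPartition-++-replicate : ∀ {n xs} j t → 1 ≤ t → All (t ≤_) xs → IsPartition n xs →
                           IsPartition (n + j * t) (xs ++ replicate j t)
IsPartition-++-replicate {xs = xs} j t 1≤t t≤xs (xs↓ , xs≥1 , refl) =
  Linked-≥-++-replicate j t≤xs xs↓ ,
  Allₚ.++⁺ xs≥1 (Allₚ.replicate⁺ j 1≤t) ,
  trans (sum-++ xs (replicate j t)) (cong (sum xs +_) (sum-replicate j t))

All-≤-*ʳ : ∀ {xs} t → All (1 ≤_) xs → All (t ≤_) (map (_* t) xs)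
All-≤-*ʳ t xs≥1 = Allₚ.map⁺ (All.map (λ { (s≤s _) → m≤m+n t _ }) xs≥1)

ProductTwins : ℕ → ℕ → Set
ProductTwins n ℓ =
  Σ (List ℕ) λ xs → Σ (List ℕ) λ ys →
    IsPartition n xs × length xs ≡ ℓ ×
    IsPartition n ys × length ys ≡ ℓ ×
    xs ≢ ys × product xs ≡ product ys

PreCollision : ℕ → ℕ → Set
PreCollision n k =
  Σ (List ℕ) λ λs → Σ (List ℕ) λ μs →
    IsPartition n λs × length λs ≡ k ×
    IsPartition n μs × length μs ≡ k ×
    λs ≢ μs × pre k λs ≡ pre k μs

ProductTwins⇒PreCollision : ∀ {n k} → ProductTwins n k → PreCollision n k
ProductTwins⇒PreCollision (xs , ys , xs⊢n , |xs| , ys⊢n , |ys| , xs≢ys , ∏xs≡∏ys) =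
  xs , ys , xs⊢n , |xs| , ys⊢n , |ys| , xs≢ys ,
  trans (pre-length xs |xs|) (trans (cong (_∷ []) ∏xs≡∏ys) (sym (pre-length ys |ys|)))

ProductTwins-*ʳ-++-replicate : ∀ {n ℓ} t j .{{_ : NonZero t}} →
  ProductTwins n ℓ → ProductTwins (n * t + j * t) (ℓ + j)
ProductTwins-*ʳ-++-replicate {ℓ = ℓ} t j (xs , ys , xs⊢n , |xs| , ys⊢n , |ys| , xs≢ys , ∏xs≡∏ys) =
  stretch xs , stretch ys , stretch-⊢ xs⊢n , length-stretch xs |xs| , stretch-⊢ ys⊢n , length-stretch ys |ys| ,
  (λ eq → xs≢ys (map-injective (λ {a} {b} → *-cancelʳ-≡ a b t) (++-cancelʳ (replicate j t) _ _ eq))) ,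
  trans (product-stretch xs |xs|)
        (trans (cong (λ p → p * t ^ ℓ * product (replicate j t)) ∏xs≡∏ys) (sym (product-stretch ys |ys|)))
  where
  stretch : List ℕ → List ℕ
  stretch zs = map (_* t) zs ++ replicate j t

  1≤t : 1 ≤ t
  1≤t = >-nonZero⁻¹ t

  stretch-⊢ : ∀ {m zs} → IsPartition m zs → IsPartition (m * t + j * t) (stretch zs)
  stretch-⊢ zs⊢m@(_ , zs≥1 , _) =
    IsPartition-++-replicate j t 1≤t (All-≤-*ʳ t zs≥1) (IsPartition-*ʳ t 1≤t zs⊢m)

  length-stretch : ∀ zs → length zs ≡ ℓ → length (stretch zs) ≡ ℓ + j
  length-stretch zs |zs| =
    trans (length-++ (map (_* t) zs)) (cong₂ _+_ (trans (length-map (_* t) zs) |zs|) (length-replicate j))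

  product-stretch : ∀ zs → length zs ≡ ℓ → product (stretch zs) ≡ product zs * t ^ ℓ * product (replicate j t)
  product-stretch zs refl =
    trans (product-++ (map (_* t) zs) (replicate j t)) (cong (_* product (replicate j t)) (product-map-*ʳ t zs))

twins₁₃ : ProductTwins 13 3
twins₁₃ = 6 ∷ 6 ∷ 1 ∷ [] , 9 ∷ 2 ∷ 2 ∷ [] ,
  (≤-refl ∷ 1≤ ∷ [-] , 1≤ ∷ 1≤ ∷ 1≤ ∷ [] , refl) , refl ,
  (s≤s 1≤ ∷ ≤-refl ∷ [-] , 1≤ ∷ 1≤ ∷ 1≤ ∷ [] , refl) , refl ,
  (λ ()) , refl
  where
  1≤ : ∀ {n} → 1 ≤ suc n
  1≤ = s≤s z≤n

theorem1p3 : (k : ℕ) → k ≥ 3 → (m : ℕ) →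
    ∃ λ n → m ≤ n × 1 ≤ n ×
      Σ (List ℕ) λ λs → Σ (List ℕ) λ μs →
        IsPartition n λs × length λs ≡ k ×
        IsPartition n μs × length μs ≡ k ×
        λs ≢ μs × pre k λs ≡ pre k μs
theorem1p3 (suc (suc (suc j))) (s≤s (s≤s (s≤s _))) m =
  13 * t + j * t , m≤n , s≤s z≤n ,
  ProductTwins⇒PreCollision (ProductTwins-*ʳ-++-replicate t j twins₁₃)
  where
  t : ℕ
  t = suc m
  m≤n : m ≤ 13 * t + j * t
  m≤n = ≤-trans (n≤1+n m) (≤-trans (m≤n*m t 13) (m≤m+n (13 * t) (j * t)))
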